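{- Let $K$ be an infinite field and $n\le r$ integers with $r\le 3n/2$. One can choose $R\in GL_r(K)$ and two diagonal matrices $D_1,D_2\in M_r(K)$ such that, with $Z_i=R^{ -1}D_iR$ and $A_i$ the top-left $n\times n$ block of $Z_i$ ($i=1,2$), one has $\dim\operatorname{Im}[A_1,A_2]=2(r-n)$.
   Context: $[A,B]=AB-BA$, $\operatorname{Im}A$ denotes the column space. -}

module Defs where

open import Level using (_⊔_) renaming (suc to lsuc)
open import Algebra.Bundles using (CommutativeRing)
open import Data.Nat using (ℕ; zero; suc; _≤_)
open import Data.Fin using (Fin; zero; suc; inject≤)
open import Data.Product using (Σ; ∃; _×_; _,_)
open import Relation.Nullary using (¬_)
open import Relation.Binary.PropositionalEquality using (_≡_)

record Field (c ℓ : Level.Level) : Set (lsuc (c ⊔ ℓ)) where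
  field
    commutativeRing : CommutativeRing c ℓ
  open CommutativeRing commutativeRing public
  field
    0≉1     : ¬ (0# ≈ 1#)
    inverse : ∀ x → ¬ (x ≈ 0#) → ∃ λ y → x * y ≈ 1#

Infinite : ∀ {c ℓ} → Field c ℓ → Set (c ⊔ ℓ)
Infinite K = Σ (ℕ → Carrier) λ f → ∀ m n → f m ≈ f n → m ≡ n
  where open Field K

module MatrixDefs {c ℓ} (K : Field c ℓ) where
  open Field K using (Carrier; _≈_; 0#; 1#; _+_; _*_; _-_)

  ∑ : ∀ {m} → (Fin m → Carrier) → Carrier
  ∑ {zero}  f = 0#
  ∑ {suc m} f = f zero + ∑ (λ i → f (suc i))

  Vector : ℕ → Set c
  Vector m = Fin m → Carrier

  Matrix : ℕ → ℕ → Set c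
  Matrix m n = Fin m → Fin n → Carrier

  _≈ᵥ_ : ∀ {m} → Vector m → Vector m → Set ℓ
  u ≈ᵥ v = ∀ i → u i ≈ v i

  _≈ₘ_ : ∀ {m n} → Matrix m n → Matrix m n → Set ℓ
  A ≈ₘ B = ∀ i j → A i j ≈ B i j

  _⊗_ : ∀ {m n p} → Matrix m n → Matrix n p → Matrix m p
  (A ⊗ B) i k = ∑ λ j → A i j * B j k

  _−ₘ_ : ∀ {m n} → Matrix m n → Matrix m n → Matrix m n
  (A −ₘ B) i j = A i j - B i j

  _·ᵥ_ : ∀ {m n} → Matrix m n → Vector n → Vector m
  (A ·ᵥ x) i = ∑ λ j → A i j * x j

  I : ∀ {m} → Matrix m m
  I zero    zero    = 1#
  I zero    (suc j) = 0#
  I (suc i) zero    = 0#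
  I (suc i) (suc j) = I i j

  -- S is a (two-sided) inverse of R; R ∈ GL_r(K) iff such S exists.
  IsInverse : ∀ {m} → Matrix m m → Matrix m m → Set ℓ
  IsInverse R S = ((R ⊗ S) ≈ₘ I) × ((S ⊗ R) ≈ₘ I)

  IsDiagonal : ∀ {m} → Matrix m m → Set ℓ
  IsDiagonal D = ∀ i j → ¬ (i ≡ j) → D i j ≈ 0#

  [_,_] : ∀ {m} → Matrix m m → Matrix m m → Matrix m m
  [ A , B ] = (A ⊗ B) −ₘ (B ⊗ A)

  topLeft : ∀ {n r} → n ≤ r → Matrix r r → Matrix n n
  topLeft n≤r Z i j = Z (inject≤ i n≤r) (inject≤ j n≤r)

  Im : ∀ {m n} → Matrix m n → Vector m → Set (c ⊔ ℓ)
  Im A y = ∃ λ x → (A ·ᵥ x) ≈ᵥ y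

  lincomb : ∀ {m k} → (Fin k → Carrier) → (Fin k → Vector m) → Vector m
  lincomb cs v i = ∑ λ j → cs j * v j i

  LinearlyIndependent : ∀ {m k} → (Fin k → Vector m) → Set (c ⊔ ℓ)
  LinearlyIndependent v = ∀ cs → lincomb cs v ≈ᵥ (λ _ → 0#) → ∀ j → cs j ≈ 0#

  HasDim : ∀ {m} → (Vector m → Set (c ⊔ ℓ)) → ℕ → Set (c ⊔ ℓ)
  HasDim {m} P d = Σ (Fin d → Vector m) λ v →
    (∀ j → P (v j)) × LinearlyIndependent v ×
    (∀ y → P y → ∃ λ cs → lincomb cs v ≈ᵥ y)

-- Split the r coordinates into consecutive blocks A, B, P, C of sizes k, k, m, k, where
-- k = r − n and m = n − 2k ≥ 0 (this is where 2r ≤ 3n is used); the top-left n × n window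
-- is A ∪ B ∪ P. All matrices used are block-scalar: block (X, Y) is an integer multiple of
-- the identity, and zero if X and Y have different sizes. Such matrices multiply like their
-- 4 × 4 integer coefficient tables, which are computed in ℤ and mapped into K. With D₁, D₂
-- the projections onto A and B and R given by Rᵗ, the windows of Z₁ = R⁻¹D₁R and
-- Z₂ = R⁻¹D₂R are −E_AB and −E_BA, so [A₁, A₂] = E_AA − E_BB is diagonal with 2k nonzero
-- entries ±1. Nothing here needs K to be infinite.

module Submission where

open import Defs
open import Algebra.Bundles using (CommutativeRing)
open import Data.Bool as Bool using (Bool; true; false; if_then_else_)
open import Data.Empty using (⊥-elim)
open import Data.Fin as Fin using (Fin; zero; suc; toℕ; fromℕ<; inject≤)
import Data.Fin.Properties as Fin
open import Data.Integer as ℤ using (ℤ; +_; -[1+_]; _⊖_; _◃_; sign; ∣_∣; 0ℤ; 1ℤ)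
import Data.Integer.Properties as ℤ
open import Algebra.Properties.Monoid.Sum ℤ.+-0-monoid using () renaming (sum to ∑ℤ)
open import Data.Nat as ℕ using (ℕ; zero; suc; _≤_; _<_; _<?_)
import Data.Nat.Properties as ℕ
open import Data.Product using (∃; _,_; proj₁; proj₂)
open import Data.Sign as Sign using (Sign)
open import Data.Sum using (_⊎_; inj₁; inj₂; [_,_]′)
open import Function using (_∘_; flip)
open import Relation.Nullary using (Dec; yes; no; does; ¬?; contradiction)
open import Relation.Nullary.Decidable using (_→-dec_; from-yes)
open import Relation.Binary.PropositionalEquality as ≡ using (_≡_; _≢_; cong)

module IntegerHomomorphism {c ℓ} (R : CommutativeRing c ℓ) where
  open CommutativeRing R hiding (zero)
  open import Algebra.Properties.Ring ring using (-‿involutive; -‿+-comm; -0#≈0#; -1*x≈-x)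
  open import Algebra.Properties.Semiring.Mult semiring using (_×_; ×-homo-+; ×-homo-1; ×1-homo-*)
  open import Algebra.Properties.CommutativeSemigroup *-commutativeSemigroup using (interchange)
  open import Algebra.Properties.AbelianGroup +-abelianGroup using (xyx⁻¹≈y)
  open import Algebra.Definitions.RawMonoid +-rawMonoid using (sum)
  open import Relation.Binary.Reasoning.Setoid setoid

  ι : ℤ → Carrier
  ι (+ n)     = n × 1#
  ι -[1+ n ] = - (suc n × 1#)

  ι-1 : ι 1ℤ ≈ 1#
  ι-1 = ×-homo-1 1#

  ι-⊖ : ∀ m n → ι (m ⊖ n) ≈ m × 1# - n × 1#
  ι-⊖ m       zero    = sym (trans (+-congˡ -0#≈0#) (+-identityʳ _))
  ι-⊖ zero    (suc n) = sym (+-identityˡ _)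
  ι-⊖ (suc m) (suc n) = begin
    ι (suc m ⊖ suc n)       ≡⟨ cong ι (ℤ.[1+m]⊖[1+n]≡m⊖n m n) ⟩
    ι (m ⊖ n)               ≈⟨ ι-⊖ m n ⟩
    a - b                   ≈⟨ +-congʳ (xyx⁻¹≈y 1# a) ⟨
    ((1# + a) - 1#) - b     ≈⟨ +-assoc (1# + a) (- 1#) (- b) ⟩
    (1# + a) + (- 1# - b)   ≈⟨ +-congˡ (-‿+-comm 1# b) ⟩
    (1# + a) - (1# + b)     ∎
    where a = m × 1#; b = n × 1#

  ι-+ : ∀ i j → ι (i ℤ.+ j) ≈ ι i + ι j
  ι-+ (+ m)     (+ n)     = ×-homo-+ 1# m n
  ι-+ (+ m)     -[1+ n ] = ι-⊖ m (suc n)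
  ι-+ -[1+ m ] (+ n)     = trans (ι-⊖ n (suc m)) (+-comm _ _)
  ι-+ -[1+ m ] -[1+ n ] = begin
    - (suc (suc (m ℕ.+ n)) × 1#)    ≡⟨ cong (λ k → - (suc k × 1#)) (ℕ.+-suc m n) ⟨
    - ((suc m ℕ.+ suc n) × 1#)      ≈⟨ -‿cong (×-homo-+ 1# (suc m) (suc n)) ⟩
    - (suc m × 1# + suc n × 1#)     ≈⟨ -‿+-comm _ _ ⟨
    - (suc m × 1#) - (suc n × 1#)   ∎

  ι-neg : ∀ i → ι (ℤ.- i) ≈ - ι i
  ι-neg (+ zero)  = sym -0#≈0#
  ι-neg (+ suc n) = refl
  ι-neg -[1+ n ] = sym (-‿involutive _)

  ι-- : ∀ i j → ι (i ℤ.- j) ≈ ι i - ι j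
  ι-- i j = trans (ι-+ i (ℤ.- j)) (+-congˡ (ι-neg j))

  σ : Sign → Carrier
  σ Sign.+ = 1#
  σ Sign.- = - 1#

  σ-* : ∀ s t → σ (s Sign.* t) ≈ σ s * σ t
  σ-* Sign.+ t      = sym (*-identityˡ _)
  σ-* Sign.- Sign.+ = sym (*-identityʳ _)
  σ-* Sign.- Sign.- = trans (sym (-‿involutive 1#)) (sym (-1*x≈-x (- 1#)))

  ι-◃ : ∀ s n → ι (s ◃ n) ≈ σ s * (n × 1#)
  ι-◃ s      zero    = sym (zeroʳ _)
  ι-◃ Sign.+ (suc n) = sym (*-identityˡ _)
  ι-◃ Sign.- (suc n) = sym (-1*x≈-x _)

  ι≈σ*∣∣ : ∀ i → ι i ≈ σ (sign i) * (∣ i ∣ × 1#)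
  ι≈σ*∣∣ i = trans (reflexive (cong ι (≡.sym (ℤ.◃-inverse i)))) (ι-◃ (sign i) ∣ i ∣)

  ι-* : ∀ i j → ι (i ℤ.* j) ≈ ι i * ι j
  ι-* i j = begin
    ι (sign i Sign.* sign j ◃ ∣ i ∣ ℕ.* ∣ j ∣)
      ≈⟨ ι-◃ (sign i Sign.* sign j) (∣ i ∣ ℕ.* ∣ j ∣) ⟩
    σ (sign i Sign.* sign j) * ((∣ i ∣ ℕ.* ∣ j ∣) × 1#)
      ≈⟨ *-cong (σ-* (sign i) (sign j)) (×1-homo-* ∣ i ∣ ∣ j ∣) ⟩
    (σ (sign i) * σ (sign j)) * ((∣ i ∣ × 1#) * (∣ j ∣ × 1#))
      ≈⟨ interchange _ _ _ _ ⟩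
    (σ (sign i) * (∣ i ∣ × 1#)) * (σ (sign j) * (∣ j ∣ × 1#))
      ≈⟨ *-cong (ι≈σ*∣∣ i) (ι≈σ*∣∣ j) ⟨
    ι i * ι j ∎

  ι-∑ : ∀ {t} (f : Fin t → ℤ) → ι (∑ℤ f) ≈ sum (λ i → ι (f i))
  ι-∑ {zero}  f = refl
  ι-∑ {suc t} f = trans (ι-+ (f zero) _) (+-congˡ (ι-∑ (λ i → f (suc i))))

module LinearAlgebra {c ℓ} (K : Field c ℓ) where
  open Field K hiding (zero)
  open MatrixDefs K
  open import Relation.Binary.Reasoning.Setoid setoid

  ∑-cong : ∀ {s} {f g : Fin s → Carrier} → (∀ i → f i ≈ g i) → ∑ f ≈ ∑ g
  ∑-cong {zero}  f≈g = refl
  ∑-cong {suc s} f≈g = +-cong (f≈g zero) (∑-cong (f≈g ∘ suc))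

  ∑-zero : ∀ {s} (f : Fin s → Carrier) → (∀ i → f i ≈ 0#) → ∑ f ≈ 0#
  ∑-zero {zero}  f f≈0 = refl
  ∑-zero {suc s} f f≈0 = trans (+-cong (f≈0 zero) (∑-zero (f ∘ suc) (f≈0 ∘ suc))) (+-identityʳ 0#)

  *-distribˡ-∑ : ∀ {s} x (f : Fin s → Carrier) → x * ∑ f ≈ ∑ (λ i → x * f i)
  *-distribˡ-∑ {zero}  x f = zeroʳ x
  *-distribˡ-∑ {suc s} x f = trans (distribˡ x _ _) (+-congˡ (*-distribˡ-∑ x (f ∘ suc)))

  I-·ᵥ : ∀ {s} (x : Vector s) i → (I ·ᵥ x) i ≈ x i
  I-·ᵥ x zero    = trans (+-cong (*-identityˡ (x zero)) (∑-zero _ λ j → zeroˡ (x (suc j)))) (+-identityʳ _)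
  I-·ᵥ x (suc i) = trans (+-cong (zeroˡ (x zero)) (I-·ᵥ (λ j → x (suc j)) i)) (+-identityˡ _)

  ⊗-congʳ : ∀ {a b d} {X X′ : Matrix a b} (Y : Matrix b d) → X ≈ₘ X′ → (X ⊗ Y) ≈ₘ (X′ ⊗ Y)
  ⊗-congʳ Y X≈X′ i j = ∑-cong (λ l → *-congʳ (X≈X′ i l))

  δ : ℕ → ℕ → Carrier
  δ zero    zero    = 1#
  δ zero    (suc y) = 0#
  δ (suc x) zero    = 0#
  δ (suc x) (suc y) = δ x y

  I≡δ : ∀ {s} (i j : Fin s) → I i j ≡ δ (toℕ i) (toℕ j)
  I≡δ zero    zero    = ≡.refl
  I≡δ zero    (suc j) = ≡.refl
  I≡δ (suc i) zero    = ≡.refl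
  I≡δ (suc i) (suc j) = I≡δ i j

  I-inject≤ : ∀ {d s} (d≤s : d ≤ s) (i j : Fin d) → I (inject≤ i d≤s) (inject≤ j d≤s) ≡ I i j
  I-inject≤ d≤s i j = ≡.trans (I≡δ (inject≤ i d≤s) (inject≤ j d≤s))
    (≡.trans (≡.cong₂ δ (Fin.toℕ-inject≤ i d≤s) (Fin.toℕ-inject≤ j d≤s)) (≡.sym (I≡δ i j)))

  δ-+ : ∀ o x y → δ (o ℕ.+ x) (o ℕ.+ y) ≡ δ x y
  δ-+ zero    x y = ≡.refl
  δ-+ (suc o) x y = δ-+ o x y

  δ-≢ : ∀ {x y} → x ≢ y → δ x y ≡ 0#
  δ-≢ {zero}  {zero}  x≢y = ⊥-elim (x≢y ≡.refl)
  δ-≢ {zero}  {suc y} x≢y = ≡.refl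
  δ-≢ {suc x} {zero}  x≢y = ≡.refl
  δ-≢ {suc x} {suc y} x≢y = δ-≢ (x≢y ∘ cong suc)

  I-≢ : ∀ {s} {i j : Fin s} → i ≢ j → I i j ≡ 0#
  I-≢ {i = i} {j} i≢j = ≡.trans (I≡δ i j) (δ-≢ (i≢j ∘ Fin.toℕ-injective))

  ∑< : ℕ → (ℕ → Carrier) → Carrier
  ∑< s F = ∑ {s} (F ∘ toℕ)

  ∑<-cong : ∀ s {F G : ℕ → Carrier} → (∀ x → x < s → F x ≈ G x) → ∑< s F ≈ ∑< s G
  ∑<-cong s F≈G = ∑-cong (λ i → F≈G (toℕ i) (Fin.toℕ<n i))

  ∑<-zero : ∀ s (F : ℕ → Carrier) → (∀ x → x < s → F x ≈ 0#) → ∑< s F ≈ 0#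
  ∑<-zero s F F≈0 = ∑-zero (F ∘ toℕ) (λ i → F≈0 (toℕ i) (Fin.toℕ<n i))

  ∑<-+ : ∀ a b (F : ℕ → Carrier) → ∑< (a ℕ.+ b) F ≈ ∑< a F + ∑< b (λ q → F (a ℕ.+ q))
  ∑<-+ zero    b F = sym (+-identityˡ _)
  ∑<-+ (suc a) b F = trans (+-congˡ (∑<-+ a b (F ∘ suc))) (sym (+-assoc _ _ _))

  ∑<-δ : ∀ {s p} (F : ℕ → Carrier) → p < s → ∑< s (λ q → δ p q * F q) ≈ F p
  ∑<-δ {s} {p} F p<s = begin
    ∑ {s} (λ i → δ p (toℕ i) * F (toℕ i))
      ≈⟨ ∑-cong (λ i → *-congʳ (reflexive (≡.sym (≡.trans (I≡δ j i) (cong (flip δ (toℕ i)) p≡j))))) ⟩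
    (I ·ᵥ (F ∘ toℕ)) j  ≈⟨ I-·ᵥ (F ∘ toℕ) j ⟩
    F (toℕ j)           ≡⟨ cong F p≡j ⟩
    F p                 ∎
    where
    j = fromℕ< p<s
    p≡j : toℕ j ≡ p
    p≡j = Fin.toℕ-fromℕ< p<s

  HasDim-Im-diagonal : ∀ {s} d (d≤s : d ≤ s) (M : Matrix s s) (u : Vector s) →
    (∀ i j → M i j ≈ u i * I i j) →
    (∀ i → toℕ i < d → ∃ λ v → u i * v ≈ 1#) →
    (∀ i → d ≤ toℕ i → u i ≈ 0#) →
    HasDim (Im M) d
  HasDim-Im-diagonal {s} d d≤s M u M≈uI unit null = e , e∈Im , independent , spanning
    where
    embed : Fin d → Fin s
    embed j = inject≤ j d≤s

    toℕ-embed : ∀ j → toℕ (embed j) ≡ toℕ j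
    toℕ-embed j = Fin.toℕ-inject≤ j d≤s

    e : Fin d → Vector s
    e j i = I i (embed j)

    M·ᵥ : ∀ x i → (M ·ᵥ x) i ≈ u i * x i
    M·ᵥ x i = begin
      ∑ (λ l → M i l * x l)          ≈⟨ ∑-cong (λ l → trans (*-congʳ (M≈uI i l)) (*-assoc _ _ _)) ⟩
      ∑ (λ l → u i * (I i l * x l))  ≈⟨ *-distribˡ-∑ (u i) (λ l → I i l * x l) ⟨
      u i * (I ·ᵥ x) i               ≈⟨ *-congˡ (I-·ᵥ x i) ⟩
      u i * x i                      ∎

    e∈Im : ∀ j → Im M (e j)
    e∈Im j with unit (embed j) (≡.subst (_< d) (≡.sym (toℕ-embed j)) (Fin.toℕ<n j))
    ... | v , uv≈1 = (λ i → v * e j i) , λ i → trans (M·ᵥ _ i) (scaled i (i Fin.≟ embed j))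
      where
      scaled : ∀ i → Dec (i ≡ embed j) → u i * (v * I i (embed j)) ≈ I i (embed j)
      scaled i (yes ≡.refl) = trans (sym (*-assoc _ _ _)) (trans (*-congʳ uv≈1) (*-identityˡ _))
      scaled i (no i≢j) rewrite I-≢ i≢j = trans (*-congˡ (zeroʳ v)) (zeroʳ (u i))

    independent : LinearlyIndependent e
    independent cs ∑≈0 j = begin
      cs j
        ≈⟨ I-·ᵥ cs j ⟨
      ∑ (λ l → I j l * cs l)
        ≈⟨ ∑-cong (λ l → trans (*-comm _ _) (*-congˡ (reflexive (≡.sym (I-inject≤ d≤s j l))))) ⟩
      ∑ (λ l → cs l * I (embed j) (embed l))
        ≈⟨ ∑≈0 (embed j) ⟩
      0# ∎

    spanning : ∀ y → Im M y → ∃ λ cs → lincomb cs e ≈ᵥ y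
    spanning y (x , Mx≈y) = (λ j → y (embed j)) , λ i → expand i (toℕ i <? d)
      where
      expand : ∀ i → Dec (toℕ i < d) → ∑ (λ l → y (embed l) * I i (embed l)) ≈ y i
      expand i (yes i<d) = begin
        ∑ (λ l → y (embed l) * I i (embed l))
          ≡⟨ cong (λ i → ∑ (λ l → y (embed l) * I i (embed l))) i≡j ⟩
        ∑ (λ l → y (embed l) * I (embed j) (embed l))
          ≈⟨ ∑-cong (λ l → trans (*-comm _ _) (*-congʳ (reflexive (I-inject≤ d≤s j l)))) ⟩
        ∑ (λ l → I j l * y (embed l))
          ≈⟨ I-·ᵥ (y ∘ embed) j ⟩
        y (embed j)
          ≡⟨ cong y i≡j ⟨
        y i ∎
        where
        j = fromℕ< i<d
        i≡j : i ≡ embed j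
        i≡j = Fin.toℕ-injective (≡.sym (≡.trans (toℕ-embed j) (Fin.toℕ-fromℕ< i<d)))
      expand i (no i≮d) = begin
        ∑ (λ l → y (embed l) * I i (embed l))
          ≈⟨ ∑-zero _ (λ l → trans (*-congˡ (reflexive (I-≢ (i≢embed l)))) (zeroʳ _)) ⟩
        0#           ≈⟨ zeroˡ (x i) ⟨
        0# * x i     ≈⟨ *-congʳ (null i (ℕ.≮⇒≥ i≮d)) ⟨
        u i * x i    ≈⟨ M·ᵥ x i ⟨
        (M ·ᵥ x) i   ≈⟨ Mx≈y i ⟩
        y i          ∎
        where
        i≢embed : ∀ l → i ≢ embed l
        i≢embed l i≡l = i≮d (≡.subst (_< d) (≡.sym (≡.trans (cong toℕ i≡l) (toℕ-embed l))) (Fin.toℕ<n l))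

Tag : Set
Tag = Fin 4

pattern A = Fin.zero
pattern B = Fin.suc Fin.zero
pattern P = Fin.suc (Fin.suc Fin.zero)
pattern C = Fin.suc (Fin.suc (Fin.suc Fin.zero))

Table : Set
Table = Tag → Tag → ℤ

_⊗⟨_⟩_ : Table → (Tag → ℤ) → Table → Table
(G ⊗⟨ w ⟩ H) X Z = ∑ℤ λ Y → G X Y ℤ.* (w Y ℤ.* H Y Z)

_⊗ᵗ_ : Table → Table → Table
G ⊗ᵗ H = G ⊗⟨ (λ _ → 1ℤ) ⟩ H

_−ᵗ_ : Table → Table → Table
(G −ᵗ H) X Y = G X Y ℤ.- H X Y

diagᵗ : (Tag → ℤ) → Table
diagᵗ w X Y = if does (X Fin.≟ Y) then w X else 0ℤ

1ᵗ : Table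
1ᵗ = diagᵗ (λ _ → 1ℤ)

window : Tag → ℤ
window C = 0ℤ
window _ = 1ℤ

isPadding : Tag → Bool
isPadding P = true
isPadding _ = false

SizeCompatible : Table → Set
SizeCompatible G = ∀ X Y → isPadding X ≢ isPadding Y → G X Y ≡ 0ℤ

sizeCompatible? : ∀ G → Dec (SizeCompatible G)
sizeCompatible? G = Fin.all? λ X → Fin.all? λ Y → ¬? (isPadding X Bool.≟ isPadding Y) →-dec (G X Y ℤ.≟ 0ℤ)

_≐_ : Table → Table → Set
G ≐ H = ∀ X Y → G X Y ≡ H X Y

_≐?_ : ∀ G H → Dec (G ≐ H)
G ≐? H = Fin.all? λ X → Fin.all? λ Y → G X Y ℤ.≟ H X Y

AgreeOnWindow : Table → Table → Set
AgreeOnWindow G H = ∀ X Y → window X ≡ 1ℤ → window Y ≡ 1ℤ → G X Y ≡ H X Y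

agreeOnWindow? : ∀ G H → Dec (AgreeOnWindow G H)
agreeOnWindow? G H = Fin.all? λ X → Fin.all? λ Y →
  (window X ℤ.≟ 1ℤ) →-dec ((window Y ℤ.≟ 1ℤ) →-dec (G X Y ℤ.≟ H X Y))

cut : ℕ → ℕ → ℕ ⊎ ℕ
cut a x with x <? a
... | yes _ = inj₁ x
... | no  _ = inj₂ (x ℕ.∸ a)

cut-< : ∀ {a x} → x < a → cut a x ≡ inj₁ x
cut-< {a} {x} x<a with x <? a
... | yes _   = ≡.refl
... | no  x≮a = contradiction x<a x≮a

cut-+ : ∀ a q → cut a (a ℕ.+ q) ≡ inj₂ q
cut-+ a q with a ℕ.+ q <? a
... | yes a+q<a = contradiction a+q<a (ℕ.m+n≮m a q)
... | no  _     = cong inj₂ (ℕ.m+n∸m≡n a q)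

split : ∀ a x → x < a ⊎ ∃ λ q → x ≡ a ℕ.+ q
split a x with x <? a
... | yes x<a = inj₁ x<a
... | no  x≮a = inj₂ (x ℕ.∸ a , ≡.sym (ℕ.m+[n∸m]≡n (ℕ.≮⇒≥ x≮a)))

module Layout (k m : ℕ) where
  open import Data.Nat using (_+_)
  open import Data.Product using (_×_)

  n r : ℕ
  n = k + (k + m)
  r = n + k

  size : Tag → ℕ
  size X = if isPadding X then m else k

  place : Tag → ℕ → ℕ
  place A q = q
  place B q = k + q
  place P q = k + (k + q)
  place C q = n + q

  locate : ℕ → Tag × ℕ
  locate x = [ [ (A ,_) , [ (B ,_) , (P ,_) ]′ ∘ cut k ]′ ∘ cut k , (C ,_) ]′ (cut n x)

  tag : ℕ → Tag
  tag = proj₁ ∘ locate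

  pos : ℕ → ℕ
  pos = proj₂ ∘ locate

  locate-place : ∀ X q → q < size X → locate (place X q) ≡ (X , q)
  locate-place A q q<k
    rewrite cut-< (ℕ.<-≤-trans q<k (ℕ.m≤m+n k (k + m))) | cut-< q<k = ≡.refl
  locate-place B q q<k
    rewrite cut-< (ℕ.+-monoʳ-< k (ℕ.<-≤-trans q<k (ℕ.m≤m+n k m))) | cut-+ k q | cut-< q<k = ≡.refl
  locate-place P q q<m
    rewrite cut-< (ℕ.+-monoʳ-< k (ℕ.+-monoʳ-< k q<m)) | cut-+ k (k + q) | cut-+ k q = ≡.refl
  locate-place C q q<k rewrite cut-+ n q = ≡.refl

  data Located : ℕ → Set where
    at : ∀ X q → q < size X → Located (place X q)

  located : ∀ x → x < r → Located x
  located x x<r with split n x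
  ... | inj₂ (q , ≡.refl) = at C q (ℕ.+-cancelˡ-< n q k x<r)
  ... | inj₁ x<n with split k x
  ...   | inj₁ x<k = at A x x<k
  ...   | inj₂ (q , ≡.refl) with split k q
  ...     | inj₁ q<k = at B q q<k
  ...     | inj₂ (q′ , ≡.refl) = at P q′ (ℕ.+-cancelˡ-< k q′ m (ℕ.+-cancelˡ-< k (k + q′) (k + m) x<n))

  tag-place : ∀ X q → q < size X → tag (place X q) ≡ X
  tag-place X q q<size = cong proj₁ (locate-place X q q<size)

  pos-place : ∀ X q → q < size X → pos (place X q) ≡ q
  pos-place X q q<size = cong proj₂ (locate-place X q q<size)

  pos<size : ∀ x → x < r → pos x < size (tag x)
  pos<size x x<r with located x x<r
  ... | at X q q<size rewrite tag-place X q q<size | pos-place X q q<size = q<size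

  tag-AB : ∀ x → x < k + k → tag x ≡ A ⊎ tag x ≡ B
  tag-AB x x<2k with split k x
  ... | inj₁ x<k         = inj₁ (tag-place A x x<k)
  ... | inj₂ (q , ≡.refl) = inj₂ (tag-place B q (ℕ.+-cancelˡ-< k q k x<2k))

  tag-P : ∀ x → k + k ≤ x → x < n → tag x ≡ P
  tag-P x 2k≤x x<n with split (k + k) x
  ... | inj₁ x<2k         = contradiction 2k≤x (ℕ.<⇒≱ x<2k)
  ... | inj₂ (q , ≡.refl) rewrite ℕ.+-assoc k k q =
    tag-place P q (ℕ.+-cancelˡ-< k q m (ℕ.+-cancelˡ-< k (k + q) (k + m) x<n))

  window-tag : ∀ x → x < n → window (tag x) ≡ 1ℤ
  window-tag x x<n with x <? k + k
  ... | yes x<2k = [ cong window , cong window ]′ (tag-AB x x<2k)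
  ... | no  x≮2k = cong window (tag-P x (ℕ.≮⇒≥ x≮2k) x<n)

module BlockMatrices {c ℓ} (K : Field c ℓ) (k m : ℕ) where
  open Field K hiding (zero)
  open MatrixDefs K
  open LinearAlgebra K
  open IntegerHomomorphism commutativeRing
  open Layout k m
  open import Algebra.Solver.CommutativeMonoid *-commutativeMonoid using (solve; _⊕_; _⊜_)
  open import Algebra.Properties.CommutativeSemigroup *-commutativeSemigroup using (x∙yz≈y∙xz)
  open import Algebra.Properties.Ring ring using (-‿distribˡ-*)
  open import Relation.Binary.Reasoning.Setoid setoid

  entry : Table → ℕ → ℕ → Carrier
  entry G x y = ι (G (tag x) (tag y)) * δ (pos x) (pos y)

  block : Table → Matrix r r
  block G i j = entry G (toℕ i) (toℕ j)

  ι-⊗⟨⟩ : ∀ G (w : Tag → ℤ) H X Z →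
    ι ((G ⊗⟨ w ⟩ H) X Z) ≈ ∑ (λ Y → ι (G X Y) * (ι (w Y) * ι (H Y Z)))
  ι-⊗⟨⟩ G w H X Z = trans (ι-∑ (λ Y → G X Y ℤ.* (w Y ℤ.* H Y Z)))
    (∑-cong {g = λ Y → ι (G X Y) * (ι (w Y) * ι (H Y Z))}
      (λ Y → trans (ι-* (G X Y) (w Y ℤ.* H Y Z)) (*-congˡ (ι-* (w Y) (H Y Z)))))

  block-sum : ∀ F → ∑< r F ≈ ∑ (λ Y → ∑< (size Y) (F ∘ place Y))
  block-sum F = begin
    ∑< (n ℕ.+ k) F                   ≈⟨ ∑<-+ n k F ⟩
    ∑< n F + c′                      ≈⟨ +-congʳ (∑<-+ k (k ℕ.+ m) F) ⟩
    (a + ∑< (k ℕ.+ m) (F ∘ place B)) + c′  ≈⟨ +-congʳ (+-congˡ (∑<-+ k m (F ∘ place B))) ⟩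
    (a + (b + p)) + c′               ≈⟨ +-assoc a (b + p) c′ ⟩
    a + ((b + p) + c′)               ≈⟨ +-congˡ (+-assoc b p c′) ⟩
    a + (b + (p + c′))               ≈⟨ +-congˡ (+-congˡ (+-congˡ (+-identityʳ c′))) ⟨
    a + (b + (p + (c′ + 0#)))        ∎
    where
    a = ∑< k (F ∘ place A)
    b = ∑< k (F ∘ place B)
    p = ∑< m (F ∘ place P)
    c′ = ∑< k (F ∘ place C)

  -- Compatibility is what makes the blocks Y with pos x ≥ size Y contribute nothing.
  product-block : ∀ {G} → SizeCompatible G → ∀ {x} → x < r → (w : Tag → ℤ) (H : Table) (z : ℕ) (Y : Tag) →
    ∑< (size Y) (λ q → entry G x (place Y q) * (ι (w (tag (place Y q))) * entry H (place Y q) z))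
      ≈ δ (pos x) (pos z) * (ι (G (tag x) Y) * (ι (w Y) * ι (H Y (tag z))))
  product-block {G} compatible {x} x<r w H z Y = begin
    ∑< (size Y) (λ q → entry G x (place Y q) * (ι (w (tag (place Y q))) * entry H (place Y q) z))
      ≈⟨ ∑<-cong (size Y) {G = λ q → δ (pos x) q * (coefficient * δ q (pos z))}
           (λ q q<size → trans (reflexive (at-place q q<size)) (rearrange _ _ _ _ _)) ⟩
    ∑< (size Y) (λ q → δ (pos x) q * (coefficient * δ q (pos z)))
      ≈⟨ select (pos x <? size Y) ⟩
    δ (pos x) (pos z) * coefficient ∎
    where
    coefficient = ι (G (tag x) Y) * (ι (w Y) * ι (H Y (tag z)))

    at-place : ∀ q → q < size Y →
      entry G x (place Y q) * (ι (w (tag (place Y q))) * entry H (place Y q) z)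
        ≡ (ι (G (tag x) Y) * δ (pos x) q) * (ι (w Y) * (ι (H Y (tag z)) * δ q (pos z)))
    at-place q q<size rewrite tag-place Y q q<size | pos-place Y q q<size = ≡.refl

    rearrange : ∀ g d w h d′ → (g * d) * (w * (h * d′)) ≈ d * ((g * (w * h)) * d′)
    rearrange = solve 5 (λ g d w h d′ → (g ⊕ d) ⊕ (w ⊕ (h ⊕ d′)) ⊜ d ⊕ ((g ⊕ (w ⊕ h)) ⊕ d′)) refl

    select : Dec (pos x < size Y) →
      ∑< (size Y) (λ q → δ (pos x) q * (coefficient * δ q (pos z))) ≈ δ (pos x) (pos z) * coefficient
    select (yes px<size) = trans (∑<-δ (λ q → coefficient * δ q (pos z)) px<size) (*-comm _ _)
    select (no  px≮size) = trans (∑<-zero (size Y) _ (λ q _ → vanishes (δ (pos x) q) (δ q (pos z))))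
                                 (sym (trans (*-congˡ coefficient≈0) (zeroʳ _)))
      where
      G≡0 : G (tag x) Y ≡ 0ℤ
      G≡0 = compatible (tag x) Y λ same → px≮size (≡.subst (pos x <_) (cong (if_then m else k) same) (pos<size x x<r))
      coefficient≈0 : coefficient ≈ 0#
      coefficient≈0 rewrite G≡0 = zeroˡ _
      vanishes : ∀ d d′ → d * (coefficient * d′) ≈ 0#
      vanishes d d′ = trans (*-congˡ (trans (*-congʳ coefficient≈0) (zeroˡ d′))) (zeroʳ d)

  entry-⊗⟨⟩ : ∀ {G} → SizeCompatible G → ∀ {x} → x < r → (w : Tag → ℤ) (H : Table) (z : ℕ) →
    ∑< r (λ y → entry G x y * (ι (w (tag y)) * entry H y z)) ≈ entry (G ⊗⟨ w ⟩ H) x z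
  entry-⊗⟨⟩ {G} compatible {x} x<r w H z = begin
    ∑< r F                                                ≈⟨ block-sum F ⟩
    ∑ (λ Y → ∑< (size Y) (F ∘ place Y))                   ≈⟨ ∑-cong {f = λ Y → ∑< (size Y) (F ∘ place Y)}
                                                                     (product-block compatible x<r w H z) ⟩
    ∑ (λ Y → δ (pos x) (pos z) * coefficient Y)           ≈⟨ *-distribˡ-∑ (δ (pos x) (pos z)) coefficient ⟨
    δ (pos x) (pos z) * ∑ coefficient                     ≈⟨ *-congˡ (ι-⊗⟨⟩ G w H (tag x) (tag z)) ⟨
    δ (pos x) (pos z) * ι ((G ⊗⟨ w ⟩ H) (tag x) (tag z))  ≈⟨ *-comm _ _ ⟩
    entry (G ⊗⟨ w ⟩ H) x z                                ∎
    where
    F : ℕ → Carrier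
    F y = entry G x y * (ι (w (tag y)) * entry H y z)
    coefficient : Tag → Carrier
    coefficient Y = ι (G (tag x) Y) * (ι (w Y) * ι (H Y (tag z)))

  block-⊗ : ∀ {G} → SizeCompatible G → ∀ H → (block G ⊗ block H) ≈ₘ block (G ⊗ᵗ H)
  block-⊗ {G} compatible H i j = trans
    (∑<-cong r {G = λ y → entry G (toℕ i) y * (ι 1ℤ * entry H y (toℕ j))}
      (λ y _ → *-congˡ (sym (trans (*-congʳ ι-1) (*-identityˡ _)))))
    (entry-⊗⟨⟩ compatible (Fin.toℕ<n i) (λ _ → 1ℤ) H (toℕ j))

  window-sum : ∀ F → ∑< n F ≈ ∑< r (λ y → ι (window (tag y)) * F y)
  window-sum F = sym (begin
    ∑< (n ℕ.+ k) (λ y → ι (window (tag y)) * F y)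
      ≈⟨ ∑<-+ n k (λ y → ι (window (tag y)) * F y) ⟩
    ∑< n (λ y → ι (window (tag y)) * F y) + ∑< k (λ q → ι (window (tag (n ℕ.+ q))) * F (n ℕ.+ q))
      ≈⟨ +-cong (∑<-cong n inside) (∑<-zero k _ outside) ⟩
    ∑< n F + 0#
      ≈⟨ +-identityʳ _ ⟩
    ∑< n F ∎)
    where
    inside : ∀ y → y < n → ι (window (tag y)) * F y ≈ F y
    inside y y<n rewrite window-tag y y<n = trans (*-congʳ ι-1) (*-identityˡ (F y))
    outside : ∀ q → q < k → ι (window (tag (n ℕ.+ q))) * F (n ℕ.+ q) ≈ 0#
    outside q q<k rewrite tag-place C q q<k = zeroˡ _

  entry-topLeft : ∀ (n≤r : n ≤ r) {Z G} → Z ≈ₘ block G → ∀ i j →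
    topLeft n≤r Z i j ≈ entry G (toℕ i) (toℕ j)
  entry-topLeft n≤r {Z} {G} Z≈G i j =
    trans (Z≈G _ _) (reflexive (≡.cong₂ (entry G) (Fin.toℕ-inject≤ i n≤r) (Fin.toℕ-inject≤ j n≤r)))

  topLeft-⊗ : ∀ (n≤r : n ≤ r) {Z W G H} → SizeCompatible G → Z ≈ₘ block G → W ≈ₘ block H → ∀ i j →
    (topLeft n≤r Z ⊗ topLeft n≤r W) i j ≈ entry (G ⊗⟨ window ⟩ H) (toℕ i) (toℕ j)
  topLeft-⊗ n≤r {Z} {W} {G} {H} compatible Z≈G W≈H i j = begin
    ∑ (λ l → topLeft n≤r Z i l * topLeft n≤r W l j)
      ≈⟨ ∑-cong (λ l → *-cong (entry-topLeft n≤r {G = G} Z≈G i l) (entry-topLeft n≤r {G = H} W≈H l j)) ⟩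
    ∑< n (λ y → entry G x y * entry H y z)
      ≈⟨ window-sum (λ y → entry G x y * entry H y z) ⟩
    ∑< r (λ y → ι (window (tag y)) * (entry G x y * entry H y z))
      ≈⟨ ∑<-cong r (λ y _ → x∙yz≈y∙xz (ι (window (tag y))) (entry G x y) (entry H y z)) ⟩
    ∑< r (λ y → entry G x y * (ι (window (tag y)) * entry H y z))
      ≈⟨ entry-⊗⟨⟩ compatible x<r window H z ⟩
    entry (G ⊗⟨ window ⟩ H) x z ∎
    where
    x = toℕ i
    z = toℕ j
    x<r : x < r
    x<r = ℕ.<-≤-trans (Fin.toℕ<n i) (ℕ.m≤m+n n k)

  entry-− : ∀ G H x y → entry G x y - entry H x y ≈ entry (G −ᵗ H) x y
  entry-− G H x y = begin
    ι g * d - ι h * d     ≈⟨ +-congˡ (-‿distribˡ-* (ι h) d) ⟩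
    ι g * d + - ι h * d   ≈⟨ distribʳ d (ι g) (- ι h) ⟨
    (ι g - ι h) * d       ≈⟨ *-congʳ (ι-- g h) ⟨
    ι (g ℤ.- h) * d       ∎
    where
    g = G (tag x) (tag y)
    h = H (tag x) (tag y)
    d = δ (pos x) (pos y)

  δ-place : ∀ X q q′ → δ (place X q) (place X q′) ≡ δ q q′
  δ-place A q q′ = ≡.refl
  δ-place B q q′ = δ-+ k q q′
  δ-place P q q′ = ≡.trans (δ-+ k (k ℕ.+ q) (k ℕ.+ q′)) (δ-+ k q q′)
  δ-place C q q′ = δ-+ n q q′

  entry-diag : ∀ w {x y} → x < r → y < r → entry (diagᵗ w) x y ≈ ι (w (tag x)) * δ x y
  entry-diag w {x} {y} x<r y<r with located x x<r | located y y<r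
  ... | at X q q<size | at Y q′ q′<size
    rewrite tag-place X q q<size | pos-place X q q<size | tag-place Y q′ q′<size | pos-place Y q′ q′<size
    with X Fin.≟ Y
  ... | yes ≡.refl = *-congˡ (reflexive (≡.sym (δ-place X q q′)))
  ... | no  X≢Y = trans (zeroˡ _) (sym (trans (*-congˡ (reflexive (δ-≢ place≢))) (zeroʳ _)))
    where
    place≢ : place X q ≢ place Y q′
    place≢ e = X≢Y (≡.trans (≡.sym (tag-place X q q<size)) (≡.trans (cong tag e) (tag-place Y q′ q′<size)))

  block-≐ : ∀ {G H} → G ≐ H → block G ≈ₘ block H
  block-≐ G≐H i j = *-congʳ (reflexive (cong ι (G≐H (tag (toℕ i)) (tag (toℕ j)))))

  block-1ᵗ : block 1ᵗ ≈ₘ I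
  block-1ᵗ i j = begin
    block 1ᵗ i j                    ≈⟨ entry-diag (λ _ → 1ℤ) (Fin.toℕ<n i) (Fin.toℕ<n j) ⟩
    ι 1ℤ * δ (toℕ i) (toℕ j)        ≈⟨ trans (*-congʳ ι-1) (*-identityˡ _) ⟩
    δ (toℕ i) (toℕ j)               ≡⟨ I≡δ i j ⟨
    I i j                           ∎

  block-diagonal : ∀ w → IsDiagonal (block (diagᵗ w))
  block-diagonal w i j i≢j = begin
    block (diagᵗ w) i j                       ≈⟨ entry-diag w (Fin.toℕ<n i) (Fin.toℕ<n j) ⟩
    ι (w (tag (toℕ i))) * δ (toℕ i) (toℕ j)
      ≡⟨ cong (ι (w (tag (toℕ i))) *_) (δ-≢ (i≢j ∘ Fin.toℕ-injective)) ⟩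
    ι (w (tag (toℕ i))) * 0#                  ≈⟨ zeroʳ _ ⟩
    0#                                        ∎

Rᵗ : Table
Rᵗ A B = ℤ.-1ℤ
Rᵗ A C = 1ℤ
Rᵗ B A = ℤ.-1ℤ
Rᵗ B C = 1ℤ
Rᵗ P P = 1ℤ
Rᵗ C A = 1ℤ
Rᵗ C B = 1ℤ
Rᵗ C C = ℤ.-1ℤ
Rᵗ _ _ = 0ℤ

R⁻¹ᵗ : Table
R⁻¹ᵗ A A = 1ℤ
R⁻¹ᵗ A C = 1ℤ
R⁻¹ᵗ B B = 1ℤ
R⁻¹ᵗ B C = 1ℤ
R⁻¹ᵗ P P = 1ℤ
R⁻¹ᵗ C A = 1ℤ
R⁻¹ᵗ C B = 1ℤ
R⁻¹ᵗ C C = 1ℤ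
R⁻¹ᵗ _ _ = 0ℤ

D₁ᵗ D₂ᵗ Z₁ᵗ Z₂ᵗ : Table
D₁ᵗ = diagᵗ (1ᵗ A)
D₂ᵗ = diagᵗ (1ᵗ B)
Z₁ᵗ = (R⁻¹ᵗ ⊗ᵗ D₁ᵗ) ⊗ᵗ Rᵗ
Z₂ᵗ = (R⁻¹ᵗ ⊗ᵗ D₂ᵗ) ⊗ᵗ Rᵗ

ε : Tag → ℤ
ε A = 1ℤ
ε B = ℤ.-1ℤ
ε _ = 0ℤ

commutatorᵗ : Table
commutatorᵗ = (Z₁ᵗ ⊗⟨ window ⟩ Z₂ᵗ) −ᵗ (Z₂ᵗ ⊗⟨ window ⟩ Z₁ᵗ)

R⊗R⁻¹ : (Rᵗ ⊗ᵗ R⁻¹ᵗ) ≐ 1ᵗ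
R⊗R⁻¹ = from-yes ((Rᵗ ⊗ᵗ R⁻¹ᵗ) ≐? 1ᵗ)

R⁻¹⊗R : (R⁻¹ᵗ ⊗ᵗ Rᵗ) ≐ 1ᵗ
R⁻¹⊗R = from-yes ((R⁻¹ᵗ ⊗ᵗ Rᵗ) ≐? 1ᵗ)

commutator-window : AgreeOnWindow commutatorᵗ (diagᵗ ε)
commutator-window = from-yes (agreeOnWindow? commutatorᵗ (diagᵗ ε))

Rᵗ-compatible : SizeCompatible Rᵗ
Rᵗ-compatible = from-yes (sizeCompatible? Rᵗ)

R⁻¹ᵗ-compatible : SizeCompatible R⁻¹ᵗ
R⁻¹ᵗ-compatible = from-yes (sizeCompatible? R⁻¹ᵗ)

R⁻¹D₁-compatible : SizeCompatible (R⁻¹ᵗ ⊗ᵗ D₁ᵗ)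
R⁻¹D₁-compatible = from-yes (sizeCompatible? (R⁻¹ᵗ ⊗ᵗ D₁ᵗ))

R⁻¹D₂-compatible : SizeCompatible (R⁻¹ᵗ ⊗ᵗ D₂ᵗ)
R⁻¹D₂-compatible = from-yes (sizeCompatible? (R⁻¹ᵗ ⊗ᵗ D₂ᵗ))

Z₁ᵗ-compatible : SizeCompatible Z₁ᵗ
Z₁ᵗ-compatible = from-yes (sizeCompatible? Z₁ᵗ)

Z₂ᵗ-compatible : SizeCompatible Z₂ᵗ
Z₂ᵗ-compatible = from-yes (sizeCompatible? Z₂ᵗ)

ε-square : ∀ X → X ≡ A ⊎ X ≡ B → ε X ℤ.* ε X ≡ 1ℤ
ε-square A _ = ≡.refl
ε-square B _ = ≡.refl
ε-square P (inj₁ ())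
ε-square P (inj₂ ())
ε-square C (inj₁ ())
ε-square C (inj₂ ())

module Construction {c ℓ} (K : Field c ℓ) (k m : ℕ) where
  open Field K hiding (zero)
  open MatrixDefs K
  open LinearAlgebra K
  open IntegerHomomorphism commutativeRing
  open Layout k m
  open BlockMatrices K k m
  open import Relation.Binary.Reasoning.Setoid setoid

  R R⁻¹ D₁ D₂ Z₁ Z₂ : Matrix r r
  R = block Rᵗ
  R⁻¹ = block R⁻¹ᵗ
  D₁ = block D₁ᵗ
  D₂ = block D₂ᵗ
  Z₁ = (R⁻¹ ⊗ D₁) ⊗ R
  Z₂ = (R⁻¹ ⊗ D₂) ⊗ R

  R-inverse : IsInverse R R⁻¹
  R-inverse = invert Rᵗ R⁻¹ᵗ Rᵗ-compatible R⊗R⁻¹ , invert R⁻¹ᵗ Rᵗ R⁻¹ᵗ-compatible R⁻¹⊗R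
    where
    invert : ∀ G H → SizeCompatible G → (G ⊗ᵗ H) ≐ 1ᵗ → (block G ⊗ block H) ≈ₘ I
    invert G H compatible G⊗H≐1 i j =
      trans (block-⊗ compatible H i j) (trans (block-≐ G⊗H≐1 i j) (block-1ᵗ i j))

  conjugate : ∀ D → SizeCompatible (R⁻¹ᵗ ⊗ᵗ D) →
    ((R⁻¹ ⊗ block D) ⊗ R) ≈ₘ block ((R⁻¹ᵗ ⊗ᵗ D) ⊗ᵗ Rᵗ)
  conjugate D compatible i j = trans (⊗-congʳ R (block-⊗ R⁻¹ᵗ-compatible D) i j) (block-⊗ compatible Rᵗ i j)

  Z₁≈ : Z₁ ≈ₘ block Z₁ᵗ
  Z₁≈ = conjugate D₁ᵗ R⁻¹D₁-compatible

  Z₂≈ : Z₂ ≈ₘ block Z₂ᵗ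
  Z₂≈ = conjugate D₂ᵗ R⁻¹D₂-compatible

  commutator-diagonal : ∀ (n≤r : n ≤ r) i j →
    [ topLeft n≤r Z₁ , topLeft n≤r Z₂ ] i j ≈ ι (ε (tag (toℕ i))) * I i j
  commutator-diagonal n≤r i j = begin
    (topLeft n≤r Z₁ ⊗ topLeft n≤r Z₂) i j - (topLeft n≤r Z₂ ⊗ topLeft n≤r Z₁) i j
      ≈⟨ +-cong (topLeft-⊗ n≤r {H = Z₂ᵗ} Z₁ᵗ-compatible Z₁≈ Z₂≈ i j)
                (-‿cong (topLeft-⊗ n≤r {H = Z₁ᵗ} Z₂ᵗ-compatible Z₂≈ Z₁≈ i j)) ⟩
    entry (Z₁ᵗ ⊗⟨ window ⟩ Z₂ᵗ) x z - entry (Z₂ᵗ ⊗⟨ window ⟩ Z₁ᵗ) x z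
      ≈⟨ entry-− (Z₁ᵗ ⊗⟨ window ⟩ Z₂ᵗ) (Z₂ᵗ ⊗⟨ window ⟩ Z₁ᵗ) x z ⟩
    entry commutatorᵗ x z
      ≡⟨ cong (λ g → ι g * δ (pos x) (pos z))
              (commutator-window (tag x) (tag z) (window-tag x x<n) (window-tag z z<n)) ⟩
    entry (diagᵗ ε) x z
      ≈⟨ entry-diag ε (in-r x<n) (in-r z<n) ⟩
    ι (ε (tag x)) * δ x z
      ≡⟨ cong (ι (ε (tag x)) *_) (I≡δ i j) ⟨
    ι (ε (tag x)) * I i j ∎
    where
    x = toℕ i
    z = toℕ j
    x<n = Fin.toℕ<n i
    z<n = Fin.toℕ<n j
    in-r : ∀ {y} → y < n → y < r
    in-r y<n = ℕ.<-≤-trans y<n (ℕ.m≤m+n n k)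

  commutator-rank : ∀ (n≤r : n ≤ r) → HasDim (Im [ topLeft n≤r Z₁ , topLeft n≤r Z₂ ]) (k ℕ.+ k)
  commutator-rank n≤r = HasDim-Im-diagonal (k ℕ.+ k) (ℕ.+-monoʳ-≤ k (ℕ.m≤m+n k m)) _ u
    (commutator-diagonal n≤r) unit null
    where
    u : Vector n
    u i = ι (ε (tag (toℕ i)))
    unit : ∀ i → toℕ i < k ℕ.+ k → ∃ λ v → u i * v ≈ 1#
    unit i i<2k = u i , (begin
      ι (ε X) * ι (ε X)   ≈⟨ ι-* (ε X) (ε X) ⟨
      ι (ε X ℤ.* ε X)     ≡⟨ cong ι (ε-square X (tag-AB (toℕ i) i<2k)) ⟩
      ι 1ℤ                ≈⟨ ι-1 ⟩
      1#                  ∎)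
      where X = tag (toℕ i)
    null : ∀ i → k ℕ.+ k ≤ toℕ i → u i ≈ 0#
    null i 2k≤i = reflexive (cong (ι ∘ ε) (tag-P (toℕ i) 2k≤i (Fin.toℕ<n i)))

open import Level using (_⊔_)
open import Data.Nat using (_+_; _*_; _∸_)
open import Data.Product using (Σ; _×_)
open import Data.Nat.Tactic.RingSolver using (solve-∀)

CommutatorImageDim : ∀ {c ℓ} (K : Field c ℓ) {n r} → n ≤ r → ℕ → Set (c ⊔ ℓ)
CommutatorImageDim K {n} {r} n≤r d =
  Σ (Matrix r r) λ R → Σ (Matrix r r) λ R⁻¹ → IsInverse R R⁻¹ ×
  Σ (Matrix r r) λ D₁ → Σ (Matrix r r) λ D₂ → IsDiagonal D₁ × IsDiagonal D₂ ×
  HasDim (Im [ topLeft n≤r ((R⁻¹ ⊗ D₁) ⊗ R) , topLeft n≤r ((R⁻¹ ⊗ D₂) ⊗ R) ]) d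
  where open MatrixDefs K

construction : ∀ {c ℓ} (K : Field c ℓ) {n r} (n≤r : n ≤ r) k m → k + (k + m) ≡ n → n + k ≡ r →
  CommutatorImageDim K n≤r (k + k)
construction K n≤r k m ≡.refl ≡.refl =
  R , R⁻¹ , R-inverse , D₁ , D₂ , block-diagonal (1ᵗ A) , block-diagonal (1ᵗ B) , commutator-rank n≤r
  where
  open Construction K k m
  open BlockMatrices K k m using (block-diagonal)

twice-excess≤ : ∀ {n r} → n ≤ r → 2 * r ≤ 3 * n → (r ∸ n) + (r ∸ n) ≤ n
twice-excess≤ {n} {r} n≤r 2r≤3n = ℕ.+-cancelˡ-≤ (n + n) (k + k) n
  (≡.subst₂ _≤_ (double n k) (triple n)
    (≡.subst (λ r → 2 * r ≤ 3 * n) (≡.sym (ℕ.m+[n∸m]≡n n≤r)) 2r≤3n))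
  where
  k = r ∸ n
  double : ∀ a b → 2 * (a + b) ≡ (a + a) + (b + b)
  double = solve-∀
  triple : ∀ a → 3 * a ≡ (a + a) + a
  triple = solve-∀

theorem7 : ∀ {c ℓ} (K : Field c ℓ) → Infinite K →
    (n r : ℕ) (n≤r : n ≤ r) → 2 * r ≤ 3 * n →
    let open MatrixDefs K in
    Σ (Matrix r r) λ R → Σ (Matrix r r) λ R⁻¹ → IsInverse R R⁻¹ ×
    Σ (Matrix r r) λ D₁ → Σ (Matrix r r) λ D₂ → IsDiagonal D₁ × IsDiagonal D₂ ×
    HasDim (Im [ topLeft n≤r ((R⁻¹ ⊗ D₁) ⊗ R) , topLeft n≤r ((R⁻¹ ⊗ D₂) ⊗ R) ]) (2 * (r ∸ n))
theorem7 K _ n r n≤r 2r≤3n =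
  ≡.subst (CommutatorImageDim K n≤r) (cong (_+_ k) (≡.sym (ℕ.+-identityʳ k)))
    (construction K n≤r k m k+[k+m]≡n (ℕ.m+[n∸m]≡n n≤r))
  where
  k = r ∸ n
  m = n ∸ (k + k)
  k+[k+m]≡n : k + (k + m) ≡ n
  k+[k+m]≡n = ≡.trans (≡.sym (ℕ.+-assoc k k m)) (ℕ.m+[n∸m]≡n (twice-excess≤ n≤r 2r≤3n))
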